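{- Let $G$ be a finite simple graph with $n$ vertices, $m$ edges and minimum degree $\delta(G)\geqslant 1$, and let $f$ be a strongly antimagic labeling of $G$. Order the vertices as $v_1,v_2,\ldots,v_n$ so that $\phi_f(v_1)<\phi_f(v_2)<\cdots<\phi_f(v_n)$. Let $0\leqslant j\leqslant n-1$ be such that either $j+1=n$ or $\deg(v_{j+1})<\deg(v_{j+2})$. Let $G^*$ be the graph obtained from $G$ by adding one new edge $e^*=uv_{j+1}$, where either $u=v_j$ (this option being allowed only if $j\geqslant 1$ and $v_jv_{j+1}\notin E(G)$), or $u$ is a new vertex $v^*$ not in $G$. Then $G^*$ is strongly antimagic. Moreover, there exists a strongly antimagic labeling $f^*$ of $G^*$ that preserves the ordering of $V(G)$ induced by $f$, i.e. $\phi_{f^*}(v_1)<\phi_{f^*}(v_2)<\cdots<\phi_{f^*}(v_n)$.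
   Context: All graphs are finite and simple. For a graph $G$ with $m$ edges, an antimagic labeling is a bijection $f:E(G)\to\{1,\ldots,m\}$ such that the vertex sums $\phi_f(x)=\sum_{e\ni x}f(e)$ are pairwise distinct over all vertices. A strongly antimagic labeling is an antimagic labeling $f$ such that additionally $\phi_f(x)>\phi_f(y)$ whenever $\deg(x)>\deg(y)$. A graph is strongly antimagic if it admits a strongly antimagic labeling. -}

module Defs where

open import Data.Nat using (ℕ; zero; suc; _+_; _<_; _≤_)
open import Data.Fin using (Fin; toℕ; inject₁; fromℕ; _≟_)
open import Data.Bool using (Bool; if_then_else_; _∨_)
open import Data.List using (List; map; allFin)
open import Data.Nat.ListAction using (sum)
open import Data.Product using (_×_; _,_; proj₁; proj₂; Σ)
open import Data.Sum using (_⊎_)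
open import Relation.Nullary using (¬_)
open import Relation.Nullary.Decidable using (⌊_⌋)
open import Relation.Binary.PropositionalEquality using (_≡_; _≢_)
open import Function.Definitions using (Bijective; Injective)

-- A graph with vertex set Fin n and m edges, given by an injective
-- enumeration of its edges e ↦ (endpoint, endpoint).
Edges : ℕ → ℕ → Set
Edges n m = Fin m → Fin n × Fin n

SameEnds : ∀ {n} → Fin n × Fin n → Fin n × Fin n → Set
SameEnds (a , b) (c , d) = (a ≡ c × b ≡ d) ⊎ (a ≡ d × b ≡ c)

record IsSimple {n m : ℕ} (E : Edges n m) : Set where
  field
    loopless : ∀ e → proj₁ (E e) ≢ proj₂ (E e)
    noParallel : ∀ e e' → SameEnds (E e) (E e') → e ≡ e'

Adjacent : ∀ {n m} → Edges n m → Fin n → Fin n → Set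
Adjacent {m = m} E a b = Σ (Fin m) λ e → SameEnds (E e) (a , b)

incident : ∀ {n} → Fin n → Fin n × Fin n → Bool
incident x (a , b) = ⌊ x ≟ a ⌋ ∨ ⌊ x ≟ b ⌋

deg : ∀ {n m} → Edges n m → Fin n → ℕ
deg {m = m} E x = sum (map (λ e → if incident x (E e) then 1 else 0) (allFin m))

-- An edge labeling is a bijection E(G) → {1,…,m}; we encode it as a
-- bijection f : Fin m → Fin m, the label of edge e being toℕ (f e) + 1.
label : ∀ {m} → (Fin m → Fin m) → Fin m → ℕ
label f e = suc (toℕ (f e))

φ : ∀ {n m} → Edges n m → (Fin m → Fin m) → Fin n → ℕ
φ {m = m} E f x = sum (map (λ e → if incident x (E e) then label f e else 0) (allFin m))

IsAntimagic : ∀ {n m} → Edges n m → (Fin m → Fin m) → Set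
IsAntimagic E f = Bijective _≡_ _≡_ f × Injective _≡_ _≡_ (φ E f)

IsStronglyAntimagic : ∀ {n m} → Edges n m → (Fin m → Fin m) → Set
IsStronglyAntimagic E f =
  IsAntimagic E f × (∀ x y → deg E y < deg E x → φ E f y < φ E f x)

addEdge : ∀ {n m} → Edges n m → Fin n × Fin n → Edges n (suc m)
addEdge E p Fin.zero = p
addEdge E p (Fin.suc e) = E e

-- G viewed inside a vertex set with one new vertex (fromℕ n).
liftVert : ∀ {n m} → Edges n m → Edges (suc n) m
liftVert E e = inject₁ (proj₁ (E e)) , inject₁ (proj₂ (E e))

{-# OPTIONS --safe #-}
module Submission where

-- Give the new edge the label 1 and raise every old label by one: then every vertex sum
-- becomes φ* = deg* + φ, with deg* the degree in G*.  Since f is strongly antimagic, the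
-- degree is non-decreasing along the φ-order, and the new edge raises it only at the
-- positions j, j+1, just before a strict degree jump (or at the end); so deg* is still
-- non-decreasing along the order, φ* is strictly increasing along it, and this makes φ*
-- injective and strongly antimagic.  A new endpoint v* is handled by first adding v* as
-- an isolated vertex, placed first in the order.

open import Defs
open import Data.Nat using (ℕ; suc; _+_; _<_; _≤_)
open import Data.Fin using (Fin; toℕ; inject₁; fromℕ)
open import Data.Product using (_×_; _,_; Σ)
open import Data.Sum using (_⊎_)
open import Relation.Nullary using (¬_)
open import Relation.Binary.PropositionalEquality using (_≡_)
open import Function.Definitions using (Bijective)

open import Data.Bool using (Bool; true; false; if_then_else_; _∨_)
open import Data.Empty using (⊥-elim)
open import Data.Fin using (zero; suc; _≟_; lift; lower₁)
open import Data.Fin.Properties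
  using ( toℕ-injective; toℕ<n; toℕ-fromℕ; inject₁-injective; inject₁-lower₁; fromℕ≢inject₁
        ; lift-injective)
open import Data.List using (List; []; _∷_; map; allFin)
open import Data.List.Properties using (map-tabulate; map-cong)
open import Data.Nat using (s≤s; z≤n)
import Data.Nat as ℕ
open import Data.Nat.ListAction using (sum)
open import Data.Nat.Properties
  using ( +-commutativeSemigroup; +-assoc; ≤-reflexive; ≤-trans; <-irrefl; <-asym; <⇒≤; <⇒≱
        ; ≮⇒≥; ≤-<-trans; <-≤-trans; ≤∧≢⇒<; <-cmp; _<?_; n≤1+n; m≤m+n; m≤n⇒m≤1+n
        ; m≤n⇒m<n∨m≡n; +-mono-≤-<)
  renaming (_≟_ to _≟ℕ_)
open import Algebra.Properties.CommutativeSemigroup +-commutativeSemigroup using (interchange)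
open import Data.Product using (∃; proj₁; proj₂; map₂)
open import Data.Sum using (inj₁; inj₂; [_,_])
open import Function using (_∘_; _⇔_; mk⇔; Equivalence)
open import Function.Definitions using (Injective; Surjective)
open import Relation.Binary.Definitions using (tri<; tri≈; tri>)
open import Relation.Binary.PropositionalEquality
  using (_≢_; refl; sym; trans; cong; cong₂; subst; subst₂; module ≡-Reasoning)
open import Relation.Nullary using (yes; no; contradiction; Dec)
open import Relation.Nullary.Decidable using (⌊_⌋; isYes≗does; does-⇔; dec-false)

indicator : Bool → ℕ
indicator b = if b then 1 else 0

indicator-+-mono-≤ : ∀ {β β' d d'} → d ≤ d' → (β ≡ true → β' ≡ false → d < d') →
  indicator β + d ≤ indicator β' + d'
indicator-+-mono-≤ {false} {false} d≤d' _ = d≤d'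
indicator-+-mono-≤ {false} {true}  d≤d' _ = m≤n⇒m≤1+n d≤d'
indicator-+-mono-≤ {true}  {true}  d≤d' _ = s≤s d≤d'
indicator-+-mono-≤ {true}  {false} _ d<d' = d<d' refl refl

sum-map-+ : ∀ {A : Set} (g h : A → ℕ) (xs : List A) →
  sum (map (λ a → g a + h a) xs) ≡ sum (map g xs) + sum (map h xs)
sum-map-+ g h [] = refl
sum-map-+ g h (x ∷ xs) =
  trans (cong (g x + h x +_) (sum-map-+ g h xs)) (interchange (g x) (h x) _ _)

sum-map-zero : ∀ {A : Set} (xs : List A) → sum (map (λ _ → 0) xs) ≡ 0
sum-map-zero []       = refl
sum-map-zero (_ ∷ xs) = sum-map-zero xs

sum-map-allFin-suc : ∀ {m} (g : Fin (suc m) → ℕ) →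
  sum (map g (allFin (suc m))) ≡ g zero + sum (map (g ∘ suc) (allFin m))
sum-map-allFin-suc g =
  cong (λ xs → g zero + sum xs) (trans (map-tabulate suc g) (sym (map-tabulate (λ e → e) (g ∘ suc))))

isYes-⇔ : ∀ {A B : Set} → A ⇔ B → (a? : Dec A) (b? : Dec B) → ⌊ a? ⌋ ≡ ⌊ b? ⌋
isYes-⇔ A⇔B a? b? = trans (isYes≗does a?) (trans (does-⇔ A⇔B a? b?) (sym (isYes≗does b?)))

incident≡true⇔ : ∀ {n} (x a b : Fin n) → incident x (a , b) ≡ true ⇔ (x ≡ a ⊎ x ≡ b)
incident≡true⇔ x a b with x ≟ a | x ≟ b
... | yes x≡a | _       = mk⇔ (λ _ → inj₁ x≡a) (λ _ → refl)
... | no _    | yes x≡b = mk⇔ (λ _ → inj₂ x≡b) (λ _ → refl)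
... | no x≢a  | no x≢b  = mk⇔ (λ ()) (⊥-elim ∘ [ x≢a , x≢b ])

incident-inject₁ : ∀ {n} (x a b : Fin n) →
  incident (inject₁ x) (inject₁ a , inject₁ b) ≡ incident x (a , b)
incident-inject₁ x a b = cong₂ _∨_ (same x a) (same x b)
  where
  same : ∀ {n} (x a : Fin n) → ⌊ inject₁ x ≟ inject₁ a ⌋ ≡ ⌊ x ≟ a ⌋
  same x a = isYes-⇔ (mk⇔ inject₁-injective (cong inject₁)) _ _

incident-fromℕ : ∀ {n} (a b : Fin n) → incident (fromℕ n) (inject₁ a , inject₁ b) ≡ false
incident-fromℕ a b = cong₂ _∨_ (never a) (never b)
  where
  never : ∀ {n} (a : Fin n) → ⌊ fromℕ n ≟ inject₁ a ⌋ ≡ false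
  never {n} a =
    trans (isYes≗does (fromℕ n ≟ inject₁ a)) (dec-false (fromℕ n ≟ inject₁ a) (fromℕ≢inject₁ {i = a}))

-- deg E x and φ E f x are definitionally incidenceSum E (λ _ → 1) x and incidenceSum E (label f) x.
incidenceSum : ∀ {n m} → Edges n m → (Fin m → ℕ) → Fin n → ℕ
incidenceSum {m = m} E w x = sum (map (λ e → if incident x (E e) then w e else 0) (allFin m))

incidenceSum-suc : ∀ {n m} (E : Edges n m) (w : Fin m → ℕ) x →
  incidenceSum E (ℕ.suc ∘ w) x ≡ deg E x + incidenceSum E w x
incidenceSum-suc {m = m} E w x =
  trans (cong sum (map-cong split (allFin m))) (sum-map-+ _ _ (allFin m))
  where
  split : ∀ e → (if incident x (E e) then suc (w e) else 0)
              ≡ indicator (incident x (E e)) + (if incident x (E e) then w e else 0)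
  split e with incident x (E e)
  ... | true  = refl
  ... | false = refl

incidenceSum-addEdge : ∀ {n m} (E : Edges n m) p (w : Fin (suc m) → ℕ) x →
  incidenceSum (addEdge E p) w x ≡ (if incident x p then w zero else 0) + incidenceSum E (w ∘ suc) x
incidenceSum-addEdge E p w x = sum-map-allFin-suc (λ e → if incident x (addEdge E p e) then w e else 0)

incidenceSum-liftVert-inject₁ : ∀ {n m} (E : Edges n m) (w : Fin m → ℕ) x →
  incidenceSum (liftVert E) w (inject₁ x) ≡ incidenceSum E w x
incidenceSum-liftVert-inject₁ {m = m} E w x = cong sum (map-cong same (allFin m))
  where
  same : ∀ e → (if incident (inject₁ x) (liftVert E e) then w e else 0) ≡ (if incident x (E e) then w e else 0)
  same e = cong (λ b → if b then w e else 0) (incident-inject₁ x (proj₁ (E e)) (proj₂ (E e)))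

incidenceSum-liftVert-fromℕ : ∀ {n m} (E : Edges n m) (w : Fin m → ℕ) →
  incidenceSum (liftVert E) w (fromℕ n) ≡ 0
incidenceSum-liftVert-fromℕ {n} {m} E w = trans (cong sum (map-cong none (allFin m))) (sum-map-zero (allFin m))
  where
  none : ∀ e → (if incident (fromℕ n) (liftVert E e) then w e else 0) ≡ 0
  none e = cong (λ b → if b then w e else 0) (incident-fromℕ (proj₁ (E e)) (proj₂ (E e)))

deg≤φ : ∀ {n m} (E : Edges n m) f x → deg E x ≤ φ E f x
deg≤φ E f x = subst (deg E x ≤_) (sym (incidenceSum-suc E (toℕ ∘ f) x)) (m≤m+n _ _)

deg-addEdge : ∀ {n m} (E : Edges n m) p x → deg (addEdge E p) x ≡ indicator (incident x p) + deg E x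
deg-addEdge E p = incidenceSum-addEdge E p (λ _ → 1)

φ-addEdge-lift : ∀ {n m} (E : Edges n m) p f x →
  φ (addEdge E p) (lift 1 f) x ≡ deg (addEdge E p) x + φ E f x
φ-addEdge-lift E p f x = begin
  φ (addEdge E p) (lift 1 f) x
    ≡⟨ incidenceSum-addEdge E p _ x ⟩
  χ + incidenceSum E (ℕ.suc ∘ label f) x
    ≡⟨ cong (χ +_) (incidenceSum-suc E (label f) x) ⟩
  χ + (deg E x + φ E f x)
    ≡⟨ sym (+-assoc χ (deg E x) (φ E f x)) ⟩
  (χ + deg E x) + φ E f x
    ≡⟨ cong (_+ φ E f x) (sym (deg-addEdge E p x)) ⟩
  deg (addEdge E p) x + φ E f x
    ∎
  where
  open ≡-Reasoning
  χ : ℕ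
  χ = indicator (incident x p)

lift₁-bijective : ∀ {m} {f : Fin m → Fin m} → Bijective _≡_ _≡_ f → Bijective _≡_ _≡_ (lift 1 f)
lift₁-bijective {f = f} (f-inj , f-surj) = lift-injective f f-inj 1 , surj
  where
  surj : Surjective _≡_ _≡_ (lift 1 f)
  surj zero    = zero , λ { refl → refl }
  surj (suc y) = suc (proj₁ (f-surj y)) , λ { refl → cong suc (proj₂ (f-surj y) refl) }

StrictlyFollows : ∀ {n} → (Fin n → ℕ) → (Fin n → ℕ) → Set
StrictlyFollows h d = ∀ x y → d y < d x → h y < h x

module _ {n} (σ : Fin n → Fin n) where

  StrictlyIncreasingAlong : (Fin n → ℕ) → Set
  StrictlyIncreasingAlong h = ∀ i j → toℕ i < toℕ j → h (σ i) < h (σ j)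

  MonotoneAlong : (Fin n → ℕ) → Set
  MonotoneAlong h = ∀ i j → toℕ i ≤ toℕ j → h (σ i) ≤ h (σ j)

  JumpsAfter : (Fin n → ℕ) → Fin n → Set
  JumpsAfter d k = suc (toℕ k) ≡ n ⊎ Σ (Fin n) (λ k' → toℕ k' ≡ suc (toℕ k) × d (σ k) < d (σ k'))

  SeparatedAlong : (Fin n → ℕ) → (Fin n → Bool) → Set
  SeparatedAlong d b = ∀ i j → toℕ i < toℕ j → b (σ i) ≡ true → b (σ j) ≡ false → d (σ i) < d (σ j)

  monotoneAlong-from-< : ∀ {h} → (∀ i j → toℕ i < toℕ j → h (σ i) ≤ h (σ j)) → MonotoneAlong h
  monotoneAlong-from-< {h} h-mono i j i≤j with m≤n⇒m<n∨m≡n i≤j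
  ... | inj₁ i<j = h-mono i j i<j
  ... | inj₂ i≡j = ≤-reflexive (cong (h ∘ σ) (toℕ-injective i≡j))

  strictlyIncreasingAlong∧follows⇒monotoneAlong : ∀ {h d} →
    StrictlyIncreasingAlong h → StrictlyFollows h d → MonotoneAlong d
  strictlyIncreasingAlong∧follows⇒monotoneAlong {d = d} h-inc h-follows =
    monotoneAlong-from-< {d} λ i j i<j → ≮⇒≥ λ dj<di → <-asym (h-inc i j i<j) (h-follows (σ i) (σ j) dj<di)

  jumpsAfter⇒< : ∀ {d k i j} → MonotoneAlong d → JumpsAfter d k →
    toℕ i ≤ toℕ k → toℕ k < toℕ j → d (σ i) < d (σ j)
  jumpsAfter⇒< {j = j} d-mono (inj₁ k-last) _ k<j =
    ⊥-elim (<⇒≱ (toℕ<n j) (subst (_≤ toℕ j) k-last k<j))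
  jumpsAfter⇒< {k = k} {i} {j} d-mono (inj₂ (k' , k'≡1+k , jump)) i≤k k<j =
    ≤-<-trans (d-mono i k i≤k) (<-≤-trans jump (d-mono k' j (subst (_≤ toℕ j) (sym k'≡1+k) k<j)))

  jumpsAfter⇒separated : ∀ {d k b} → MonotoneAlong d → JumpsAfter d k → b (σ k) ≡ true →
    (∀ i → b (σ i) ≡ true → toℕ i ≡ toℕ k ⊎ suc (toℕ i) ≡ toℕ k) → SeparatedAlong d b
  jumpsAfter⇒separated {d} {k} {b} d-mono jump bk marked i j i<j bi bj =
    jumpsAfter⇒< {d = d} d-mono jump (proj₁ bounds) (≤∧≢⇒< (≤-trans (proj₂ bounds) i<j) k≢j)
    where
    bounds : toℕ i ≤ toℕ k × toℕ k ≤ suc (toℕ i)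
    bounds with marked i bi
    ... | inj₁ i≡k   = ≤-reflexive i≡k , ≤-trans (≤-reflexive (sym i≡k)) (n≤1+n _)
    ... | inj₂ 1+i≡k = ≤-trans (n≤1+n _) (≤-reflexive 1+i≡k) , ≤-reflexive (sym 1+i≡k)
    k≢j : toℕ k ≢ toℕ j
    k≢j k≡j = contradiction (trans (sym bk) (trans (cong (b ∘ σ) (toℕ-injective k≡j)) bj)) λ ()

  module _ (σ-surj : Surjective _≡_ _≡_ σ) where

    position : ∀ x → ∃ λ i → σ i ≡ x
    position x = proj₁ (σ-surj x) , proj₂ (σ-surj x) refl

    strictlyIncreasingAlong⇒injective : ∀ {h} → StrictlyIncreasingAlong h → Injective _≡_ _≡_ h
    strictlyIncreasingAlong⇒injective h-inc {x} {y} hx≡hy with position x | position y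
    ... | i , refl | j , refl with <-cmp (toℕ i) (toℕ j)
    ... | tri< i<j _ _ = ⊥-elim (<-irrefl hx≡hy (h-inc i j i<j))
    ... | tri≈ _ i≡j _ = cong σ (toℕ-injective i≡j)
    ... | tri> _ _ j<i = ⊥-elim (<-irrefl (sym hx≡hy) (h-inc j i j<i))

    strictlyIncreasingAlong⇒follows : ∀ {h d} →
      MonotoneAlong d → StrictlyIncreasingAlong h → StrictlyFollows h d
    strictlyIncreasingAlong⇒follows d-mono h-inc x y dy<dx with position x | position y
    ... | i , refl | j , refl with toℕ j <? toℕ i
    ... | yes j<i = h-inc j i j<i
    ... | no j≮i  = ⊥-elim (<⇒≱ dy<dx (d-mono i j (≮⇒≥ j≮i)))

newVertexFirst : ∀ {n} → (Fin n → Fin n) → Fin (suc n) → Fin (suc n)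
newVertexFirst {n} σ zero    = fromℕ n
newVertexFirst     σ (suc i) = inject₁ (σ i)

fromℕ-or-inject₁ : ∀ {n} (x : Fin (suc n)) → x ≡ fromℕ n ⊎ ∃ λ y → x ≡ inject₁ y
fromℕ-or-inject₁ {n} x with n ≟ℕ toℕ x
... | yes n≡x = inj₁ (toℕ-injective (trans (sym n≡x) (sym (toℕ-fromℕ n))))
... | no n≢x  = inj₂ (lower₁ x n≢x , sym (inject₁-lower₁ x n≢x))

newVertexFirst-surjective : ∀ {n} {σ : Fin n → Fin n} →
  Surjective _≡_ _≡_ σ → Surjective _≡_ _≡_ (newVertexFirst σ)
newVertexFirst-surjective σ-surj x with fromℕ-or-inject₁ x
... | inj₁ refl       = zero , λ { refl → refl }
... | inj₂ (y , refl) = suc (proj₁ (σ-surj y)) , λ { refl → cong inject₁ (proj₂ (σ-surj y) refl) }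

module _ {n} {σ : Fin n → Fin n} {h : Fin n → ℕ} {h' : Fin (suc n) → ℕ}
         (h'-new : h' (fromℕ n) ≡ 0) (h'-old : ∀ x → h' (inject₁ x) ≡ h x) where

  newVertexFirst-monotoneAlong : MonotoneAlong σ h → MonotoneAlong (newVertexFirst σ) h'
  newVertexFirst-monotoneAlong h-mono zero    j       _         =
    subst (_≤ h' (newVertexFirst σ j)) (sym h'-new) z≤n
  newVertexFirst-monotoneAlong h-mono (suc i) (suc j) (s≤s i≤j) =
    subst₂ _≤_ (sym (h'-old (σ i))) (sym (h'-old (σ j))) (h-mono i j i≤j)

  module _ (h-pos : ∀ x → 0 < h x) where

    new<old : ∀ x → h' (fromℕ n) < h' (inject₁ x)
    new<old x = subst₂ _<_ (sym h'-new) (sym (h'-old x)) (h-pos x)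

    newVertexFirst-strictlyIncreasingAlong :
      StrictlyIncreasingAlong σ h → StrictlyIncreasingAlong (newVertexFirst σ) h'
    newVertexFirst-strictlyIncreasingAlong h-inc zero    (suc j) _         = new<old (σ j)
    newVertexFirst-strictlyIncreasingAlong h-inc (suc i) (suc j) (s≤s i<j) =
      subst₂ _<_ (sym (h'-old (σ i))) (sym (h'-old (σ j))) (h-inc i j i<j)

    newVertexFirst-separated : ∀ {b} →
      SeparatedAlong σ h (b ∘ inject₁) → SeparatedAlong (newVertexFirst σ) h' b
    newVertexFirst-separated separated zero    (suc j) _         _ _ = new<old (σ j)
    newVertexFirst-separated separated (suc i) (suc j) (s≤s i<j) bi bj =
      subst₂ _<_ (sym (h'-old (σ i))) (sym (h'-old (σ j))) (separated i j i<j bi bj)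

addEdge-lift-stronglyAntimagic : ∀ {n m} (E : Edges n m) (p : Fin n × Fin n)
  {f : Fin m → Fin m} → Bijective _≡_ _≡_ f →
  {σ : Fin n → Fin n} → Surjective _≡_ _≡_ σ →
  StrictlyIncreasingAlong σ (φ E f) → MonotoneAlong σ (deg E) →
  SeparatedAlong σ (deg E) (λ x → incident x p) →
  IsStronglyAntimagic (addEdge E p) (lift 1 f) × StrictlyIncreasingAlong σ (φ (addEdge E p) (lift 1 f))
addEdge-lift-stronglyAntimagic E p {f} f-bij {σ} σ-surj φ-inc deg-mono separated =
  ( (lift₁-bijective f-bij , strictlyIncreasingAlong⇒injective σ σ-surj {φ (addEdge E p) (lift 1 f)} φ*-inc)
  , strictlyIncreasingAlong⇒follows σ σ-surj {φ (addEdge E p) (lift 1 f)} {deg (addEdge E p)} deg*-mono φ*-inc)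
  , φ*-inc
  where
  deg*-mono : MonotoneAlong σ (deg (addEdge E p))
  deg*-mono = monotoneAlong-from-< σ {deg (addEdge E p)} λ i j i<j →
    subst₂ _≤_ (sym (deg-addEdge E p (σ i))) (sym (deg-addEdge E p (σ j)))
      (indicator-+-mono-≤ (deg-mono i j (<⇒≤ i<j)) (separated i j i<j))

  φ*-inc : StrictlyIncreasingAlong σ (φ (addEdge E p) (lift 1 f))
  φ*-inc i j i<j = subst₂ _<_ (sym (φ-addEdge-lift E p f (σ i))) (sym (φ-addEdge-lift E p f (σ j)))
    (+-mono-≤-< (deg*-mono i j (<⇒≤ i<j)) (φ-inc i j i<j))

module _ {n m} (E : Edges n m) {f : Fin m → Fin m} (f-bij : Bijective _≡_ _≡_ f)
         {σ : Fin n → Fin n} (σ-bij : Bijective _≡_ _≡_ σ)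
         (φ-inc : StrictlyIncreasingAlong σ (φ E f)) (deg-mono : MonotoneAlong σ (deg E))
         {k : Fin n} (jump : JumpsAfter σ (deg E) k) where

  addEdge-consecutive-stronglyAntimagic : ∀ k₀ → suc (toℕ k₀) ≡ toℕ k →
    IsStronglyAntimagic (addEdge E (σ k₀ , σ k)) (lift 1 f)
    × StrictlyIncreasingAlong σ (φ (addEdge E (σ k₀ , σ k)) (lift 1 f))
  addEdge-consecutive-stronglyAntimagic k₀ 1+k₀≡k =
    addEdge-lift-stronglyAntimagic E (σ k₀ , σ k) f-bij (proj₂ σ-bij) φ-inc deg-mono
      (jumpsAfter⇒separated σ {deg E} {b = λ x → incident x (σ k₀ , σ k)} deg-mono jump
        (Equivalence.from (incident≡true⇔ (σ k) (σ k₀) (σ k)) (inj₂ refl)) marked)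
    where
    marked : ∀ i → incident (σ i) (σ k₀ , σ k) ≡ true → toℕ i ≡ toℕ k ⊎ suc (toℕ i) ≡ toℕ k
    marked i σi-marked with Equivalence.to (incident≡true⇔ (σ i) _ _) σi-marked
    ... | inj₁ σi≡σk₀ = inj₂ (trans (cong (ℕ.suc ∘ toℕ) (proj₁ σ-bij σi≡σk₀)) 1+k₀≡k)
    ... | inj₂ σi≡σk  = inj₁ (cong toℕ (proj₁ σ-bij σi≡σk))

  addPendantEdge-stronglyAntimagic : (∀ x → 1 ≤ deg E x) →
    IsStronglyAntimagic (addEdge (liftVert E) (fromℕ n , inject₁ (σ k))) (lift 1 f)
    × StrictlyIncreasingAlong (newVertexFirst σ) (φ (addEdge (liftVert E) (fromℕ n , inject₁ (σ k))) (lift 1 f))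
  addPendantEdge-stronglyAntimagic deg-pos =
    addEdge-lift-stronglyAntimagic (liftVert E) e* f-bij
      (newVertexFirst-surjective (proj₂ σ-bij))
      (newVertexFirst-strictlyIncreasingAlong {σ = σ} {h' = φ (liftVert E) f}
        (incidenceSum-liftVert-fromℕ E (label f)) (incidenceSum-liftVert-inject₁ E (label f)) φ-pos φ-inc)
      (newVertexFirst-monotoneAlong {σ = σ} {h' = deg (liftVert E)}
        (incidenceSum-liftVert-fromℕ E (λ _ → 1)) (incidenceSum-liftVert-inject₁ E (λ _ → 1)) deg-mono)
      (newVertexFirst-separated {σ = σ} {h' = deg (liftVert E)}
        (incidenceSum-liftVert-fromℕ E (λ _ → 1)) (incidenceSum-liftVert-inject₁ E (λ _ → 1)) deg-pos
        {λ x → incident x e*}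
        (jumpsAfter⇒separated σ {deg E} {b = λ x → incident (inject₁ x) e*} deg-mono jump
          (Equivalence.from (incident≡true⇔ (inject₁ (σ k)) (fromℕ n) (inject₁ (σ k))) (inj₂ refl)) marked))
    where
    e* : Fin (suc n) × Fin (suc n)
    e* = fromℕ n , inject₁ (σ k)

    φ-pos : ∀ x → 1 ≤ φ E f x
    φ-pos x = ≤-trans (deg-pos x) (deg≤φ E f x)

    marked : ∀ i → incident (inject₁ (σ i)) e* ≡ true → toℕ i ≡ toℕ k ⊎ suc (toℕ i) ≡ toℕ k
    marked i σi-marked with Equivalence.to (incident≡true⇔ (inject₁ (σ i)) _ _) σi-marked
    ... | inj₁ σi≡new = ⊥-elim (fromℕ≢inject₁ (sym σi≡new))
    ... | inj₂ σi≡σk  = inj₁ (cong toℕ (proj₁ σ-bij (inject₁-injective σi≡σk)))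

lemma2p2 : ∀ {n m} (E : Edges n m) → IsSimple E
    → (∀ x → 1 ≤ deg E x)
    → (f : Fin m → Fin m) → IsStronglyAntimagic E f
    → (σ : Fin n → Fin n) → Bijective _≡_ _≡_ σ
    → (∀ i i' → toℕ i < toℕ i' → φ E f (σ i) < φ E f (σ i'))
    → (k : Fin n)
    → (suc (toℕ k) ≡ n
       ⊎ Σ (Fin n) (λ k' → toℕ k' ≡ suc (toℕ k) × deg E (σ k) < deg E (σ k')))
    → ((k₀ : Fin n) → suc (toℕ k₀) ≡ toℕ k → ¬ Adjacent E (σ k₀) (σ k)
         → Σ (Fin (suc m) → Fin (suc m)) λ f* →
             IsStronglyAntimagic (addEdge E (σ k₀ , σ k)) f*
             × (∀ i i' → toℕ i < toℕ i'
                 → φ (addEdge E (σ k₀ , σ k)) f* (σ i)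
                   < φ (addEdge E (σ k₀ , σ k)) f* (σ i')))
      × (Σ (Fin (suc m) → Fin (suc m)) λ f* →
             IsStronglyAntimagic (addEdge (liftVert E) (fromℕ n , inject₁ (σ k))) f*
             × (∀ i i' → toℕ i < toℕ i'
                 → φ (addEdge (liftVert E) (fromℕ n , inject₁ (σ k))) f* (inject₁ (σ i))
                   < φ (addEdge (liftVert E) (fromℕ n , inject₁ (σ k))) f* (inject₁ (σ i'))))
lemma2p2 E _ deg-pos f ((f-bij , _) , φ-follows-deg) σ σ-bij φ-inc k jump =
    (λ k₀ 1+k₀≡k _ →
       lift 1 f , addEdge-consecutive-stronglyAntimagic E f-bij σ-bij φ-inc deg-mono jump k₀ 1+k₀≡k)
  , ( lift 1 f
    , map₂ (λ φ*-inc i j i<j → φ*-inc (suc i) (suc j) (s≤s i<j))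
           (addPendantEdge-stronglyAntimagic E f-bij σ-bij φ-inc deg-mono jump deg-pos))
  where
  deg-mono : MonotoneAlong σ (deg E)
  deg-mono = strictlyIncreasingAlong∧follows⇒monotoneAlong σ {φ E f} {deg E} φ-inc φ-follows-deg
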